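{- Let $G$ be a finite connected graph with no induced subgraph isomorphic to $4K_1$ and with minimum degree $\delta(G)=1$. Then $c(G)\le 2$.
   Context: $4K_1$ is the edgeless graph on $4$ vertices. The cop number $c(G)$ is the minimum number of cops guaranteeing capture in the standard game of cops and robber (cops placed first, then robber; alternately each cop moves to an adjacent vertex or stays, then the robber moves to an adjacent vertex or stays; full information; capture when a cop occupies the robber's vertex). -}

module Defs where

open import Data.Nat using (ℕ; zero; suc; _≤_)
open import Data.Fin using (Fin)
open import Data.List using (allFin; filter; length)
open import Data.Product using (Σ; ∃; _×_; _,_)
open import Data.Sum using (_⊎_)
open import Relation.Nullary using (¬_; Dec)
open import Data.Empty using (⊥)
open import Relation.Binary.PropositionalEquality using (_≡_; _≢_)

record Graph (n : ℕ) : Set₁ where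
  field
    Adj    : Fin n → Fin n → Set
    adj?   : (u v : Fin n) → Dec (Adj u v)
    sym    : ∀ {u v} → Adj u v → Adj v u
    irrefl : ∀ {u} → ¬ Adj u u
open Graph public

module _ {n : ℕ} (G : Graph n) where

  data Reach : Fin n → Fin n → Set where
    here : ∀ {u} → Reach u u
    step : ∀ {u v w} → Adj G u v → Reach v w → Reach u w

  Connected : Set
  Connected = ∀ u v → Reach u v

  deg : Fin n → ℕ
  deg v = length (filter (adj? G v) (allFin n))

  MinDegreeIs : ℕ → Set
  MinDegreeIs d = (∀ v → d ≤ deg v) × (∃ λ v → deg v ≡ d)

  Free4K1 : Set
  Free4K1 = ∀ a b c d →
    a ≢ b → a ≢ c → a ≢ d → b ≢ c → b ≢ d → c ≢ d →
    ¬ Adj G a b → ¬ Adj G a c → ¬ Adj G a d →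
    ¬ Adj G b c → ¬ Adj G b d → ¬ Adj G c d → ⊥

  Cops : ℕ → Set
  Cops k = Fin k → Fin n

  Caught : ∀ {k} → Cops k → Fin n → Set
  Caught {k} C r = ∃ λ (i : Fin k) → C i ≡ r

  Move : Fin n → Fin n → Set
  Move x y = x ≡ y ⊎ Adj G x y

  -- CopWinFrom C r : it is the cops' turn, cops at C, robber at r, and the
  -- cops can force capture in finitely many rounds (inductive = finite).
  data CopWinFrom {k : ℕ} : Cops k → Fin n → Set where
    caught : ∀ {C r} → Caught C r → CopWinFrom C r
    move   : ∀ {C r} (C' : Cops k) → (∀ i → Move (C i) (C' i)) →
             (Caught C' r ⊎ (∀ r' → Move r r' → CopWinFrom C' r')) →
             CopWinFrom C r

  CopsWin : ℕ → Set
  CopsWin k = Σ (Cops k) λ C₀ → ∀ r₀ → CopWinFrom C₀ r₀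

  CopNumber≤ : ℕ → Set
  CopNumber≤ m = ∃ λ k → k ≤ m × CopsWin k

-- One cop guards a vertex x and thereby confines the robber to the non-neighbourhood
-- T = V ∖ N[x]. If T induces a disjoint union of cliques, the robber can never leave the
-- clique he starts in, so the second cop just walks to his starting vertex q and then
-- catches him, since he stays in N[q].
-- For a leaf v with neighbour u, such an x exists: if u has a further neighbour w, take
-- x = w, because an induced path a - b - c in T would make {w, v, a, c} an independent set;
-- otherwise G is the single edge uv and x = u dominates everything.
module Submission where

open import Defs
open import Data.Nat using (ℕ)
open import Data.Nat.Properties using (≤-refl)
open import Data.Fin using (Fin; zero; suc; _≟_)
open import Data.Fin.Properties using (any?)
open import Data.List using ([]; _∷_; allFin; filter)
open import Data.List.Membership.Propositional using (_∈_)
open import Data.List.Membership.Propositional.Properties using (∈-filter⁺; ∈-filter⁻; ∈-allFin)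
open import Data.List.Relation.Unary.Any using (here)
open import Data.Product using (∃; _×_; _,_)
open import Data.Sum using (_⊎_; inj₁; inj₂)
open import Data.Empty using (⊥-elim)
open import Relation.Nullary using (¬_; Dec; yes; no)
open import Relation.Nullary.Decidable using (_⊎-dec_; _×-dec_; ¬?)
open import Relation.Binary.PropositionalEquality using (_≡_; _≢_; refl; subst) renaming (sym to ≡-sym)

module _ {n : ℕ} (G : Graph n) where

  Near : Fin n → Fin n → Set
  Near x y = x ≡ y ⊎ Adj G x y

  Far : Fin n → Fin n → Set
  Far x y = ¬ Near x y

  near? : ∀ x y → Dec (Near x y)
  near? x y = (x ≟ y) ⊎-dec adj? G x y

  ClusterOutside : Fin n → Set
  ClusterOutside x = ∀ {a b c} → Far x a → Far x b → Far x c →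
    Adj G a b → Adj G b c → a ≢ c → Adj G a c

  reach-closed : (P : Fin n → Set) → (∀ {y z} → P y → Adj G y z → P z) →
    ∀ {y z} → P y → Reach G y z → P z
  reach-closed P closed Py here = Py
  reach-closed P closed Py (step y~y′ y′⇝z) = reach-closed P closed (closed Py y~y′) y′⇝z

  deg≡1⇒uniqueNeighbour : ∀ v → deg G v ≡ 1 →
    ∃ λ u → Adj G v u × (∀ {y} → Adj G v y → y ≡ u)
  deg≡1⇒uniqueNeighbour v d with filter (adj? G v) (allFin n) in eq | d
  ... | u ∷ [] | _ = u , adjacent (here refl) , λ v~y → unique (toList v~y)
    where
    toList : ∀ {y} → Adj G v y → y ∈ u ∷ []
    toList {y} v~y = subst (y ∈_) eq (∈-filter⁺ (adj? G v) (∈-allFin y) v~y)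
    adjacent : ∀ {y} → y ∈ u ∷ [] → Adj G v y
    adjacent y∈ with ∈-filter⁻ (adj? G v) {xs = allFin n} (subst (_ ∈_) (≡-sym eq) y∈)
    ... | _ , v~y = v~y
    unique : ∀ {y} → y ∈ u ∷ [] → y ≡ u
    unique (here y≡u) = y≡u

  free4K1⇒clusterOutside : Free4K1 G → ∀ {x v} → Far x v → (∀ {y} → Adj G v y → Near x y) →
    ClusterOutside x
  free4K1⇒clusterOutside free {x} {v} far-v nbrs-near {a} {b} {c} far-a far-b far-c a~b b~c a≢c
    with adj? G a c
  ... | yes a~c = a~c
  ... | no a≁c = ⊥-elim (free x v a c
    (λ e → far-v (inj₁ e)) (λ e → far-a (inj₁ e)) (λ e → far-c (inj₁ e))
    (λ { refl → far-b (nbrs-near a~b) }) (λ { refl → far-b (nbrs-near (Graph.sym G b~c)) }) a≢c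
    (λ x~v → far-v (inj₂ x~v)) (λ x~a → far-a (inj₂ x~a)) (λ x~c → far-c (inj₂ x~c))
    (λ v~a → far-a (nbrs-near v~a)) (λ v~c → far-c (nbrs-near v~c)) a≁c)

  isolatedEdge⇒dominating : Connected G → ∀ {u v} → Adj G u v →
    (∀ {y} → Adj G u y → y ≡ v) → (∀ {y} → Adj G v y → y ≡ u) → ∀ z → Near u z
  isolatedEdge⇒dominating conn {u} {v} u~v onlyV onlyU z =
    reach-closed (Near u) closed (inj₁ refl) (conn u z)
    where
    closed : ∀ {y z} → Near u y → Adj G y z → Near u z
    closed (inj₁ refl) u~z = inj₂ u~z
    closed (inj₂ u~y) y~z with onlyV u~y
    ... | refl = inj₁ (≡-sym (onlyU y~z))

module TwoCops {n : ℕ} (G : Graph n) (conn : Connected G) (x : Fin n)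
               (cluster : ClusterOutside G x) where

  cops : Fin n → Fin n → Cops G 2
  cops a b zero    = a
  cops a b (suc _) = b

  captureNear : ∀ b r → Near G x r → CopWinFrom G (cops x b) r
  captureNear b r (inj₁ x≡r) = caught (zero , x≡r)
  captureNear b r (inj₂ x~r) = move (cops r b) moves (inj₁ (zero , refl))
    where
    moves : ∀ i → Move G (cops x b i) (cops r b i)
    moves zero    = inj₂ x~r
    moves (suc _) = inj₁ refl

  staysNear : ∀ {q r r′} → Far G x q → Far G x r → Far G x r′ →
    Near G q r → Move G r r′ → Near G q r′
  staysNear _ _ _ r∈N[q] (inj₁ refl) = r∈N[q]
  staysNear _ _ _ (inj₁ refl) (inj₂ q~r′) = inj₂ q~r′
  staysNear {q} {r′ = r′} far-q far-r far-r′ (inj₂ q~r) (inj₂ r~r′) with q ≟ r′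
  ... | yes q≡r′ = inj₁ q≡r′
  ... | no q≢r′ = inj₂ (cluster far-q far-r far-r′ q~r r~r′ q≢r′)

  -- The first cop stays on x; the second walks from b towards q while the robber,
  -- confined to V ∖ N[x], remains in N[q].
  chase : ∀ {b q} → Reach G b q → Far G x q → ∀ r → Far G x r → Near G q r →
    CopWinFrom G (cops x b) r
  chase here _ r _ (inj₁ q≡r) = caught (suc zero , q≡r)
  chase {b} here _ r _ (inj₂ b~r) = move (cops x r) moves (inj₁ (suc zero , refl))
    where
    moves : ∀ i → Move G (cops x b i) (cops x r i)
    moves zero    = inj₁ refl
    moves (suc _) = inj₂ b~r
  chase {b} (step {v = b′} b~b′ b′⇝q) far-q r far-r r∈N[q] =
    move (cops x b′) moves (inj₂ robberMoves)
    where
    moves : ∀ i → Move G (cops x b i) (cops x b′ i)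
    moves zero    = inj₁ refl
    moves (suc _) = inj₂ b~b′
    robberMoves : ∀ r′ → Move G r r′ → CopWinFrom G (cops x b′) r′
    robberMoves r′ r→r′ with near? G x r′
    ... | yes near-r′ = captureNear b′ r′ near-r′
    ... | no far-r′ =
      chase b′⇝q far-q r′ far-r′ (staysNear far-q far-r far-r′ r∈N[q] r→r′)

  twoCopsWin : CopsWin G 2
  twoCopsWin = cops x x , start
    where
    start : ∀ r → CopWinFrom G (cops x x) r
    start r with near? G x r
    ... | yes near-r = captureNear x r near-r
    ... | no far-r   = chase (conn x r) far-r r far-r (inj₁ refl)

lemma4p1 : (n : ℕ) (G : Graph n) → Connected G → Free4K1 G → MinDegreeIs G 1 →
    CopNumber≤ G 2
lemma4p1 n G conn free (_ , v , deg≡1) with deg≡1⇒uniqueNeighbour G v deg≡1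
... | u , v~u , onlyU with any? (λ w → adj? G u w ×-dec ¬? (w ≟ v))
... | yes (w , u~w , w≢v) =
  2 , ≤-refl , TwoCops.twoCopsWin G conn w (free4K1⇒clusterOutside G free far-v nbrs-near)
  where
  far-v : Far G w v
  far-v (inj₁ w≡v) = w≢v w≡v
  far-v (inj₂ w~v) with onlyU (Graph.sym G w~v)
  ... | refl = irrefl G u~w
  nbrs-near : ∀ {y} → Adj G v y → Near G w y
  nbrs-near v~y with onlyU v~y
  ... | refl = inj₂ (Graph.sym G u~w)
... | no noOther =
  2 , ≤-refl , TwoCops.twoCopsWin G conn u (λ far-a _ _ _ _ _ → ⊥-elim (far-a (dominating _)))
  where
  onlyV : ∀ {y} → Adj G u y → y ≡ v
  onlyV {y} u~y with y ≟ v
  ... | yes y≡v = y≡v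
  ... | no y≢v = ⊥-elim (noOther (y , u~y , y≢v))
  dominating : ∀ z → Near G u z
  dominating = isolatedEdge⇒dominating G conn (Graph.sym G v~u) onlyV onlyU
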